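{- For all natural numbers $a, b \geq 1$, $$\gcd(a,b) = \left( \left( \left(-5^{ab(ab+a+b)}\right) \bmod \left( (5^{a^2 b}-1)(5^{ab^2}-1) \right) \right) \bmod 5^{ab} \right) - 2.$$
   Context: $\gcd(a,b)$ denotes the greatest common divisor of $a$ and $b$. For integers $x$ and $m \geq 1$, $x \bmod m$ denotes the least non-negative residue of $x$ modulo $m$, i.e. the unique $r \in \{0,\dots,m-1\}$ with $m \mid x - r$ (in particular it is applied here to a negative integer $x$). -}

module Defs where

open import Data.Nat.Base using (ℕ; _*_; _+_; _∸_; _^_)

-- the modulus (5^(a^2 b) - 1)(5^(a b^2) - 1); note 5^k ≥ 1 so ∸ is exact subtraction
modulus : ℕ → ℕ → ℕ
modulus a b = (5 ^ (a * a * b) ∸ 1) * (5 ^ (a * b * b) ∸ 1)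

-- Put x = 5^(ab), p = x^a − 1, q = x^b − 1 and S = ∑_{k=0}^{a} x^(bk mod a).
-- As x^(bk) ≡ x^(bk mod a) (mod p) and q · ∑_{k=0}^{a} x^(bk) = x^(b(a+1)) − 1, the
-- exponent ab + a + b = a + b(a+1) gives x^(ab+a+b) ≡ x^a + qS (mod pq); since
-- 0 < x^a + qS < pq, the residue of the negative is r = pq − x^a − qS. Modulo x we have
-- p ≡ q ≡ −1, so r ≡ 1 + S, and x^e ≡ [e = 0] gives S ≡ #{k ≤ a : a ∣ bk} = gcd(a,b) + 1.
module Submission where

open import Defs
open import Data.Nat.Base as ℕ
  using (ℕ; zero; suc; _+_; _*_; _∸_; _^_; _≤_; _<_; _≥_; s≤s; z≤n; NonZero; ≢-nonZero; >-nonZero; s≤s⁻¹)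
open import Data.Nat.Properties
open import Data.Nat.DivMod
  using (_/_; _%_; m≡m%n+[m/n]*n; [m+kn]%n≡m%n; [m+n]%n≡m%n; m<n⇒m%n≡m; n%n≡0; m%n<n; m/n*n≡m; m*[n/m]≡n; m≥n⇒m/n>0)
open import Data.Nat.Divisibility using (_∣_; ∣⇒≤; m%n≡0⇔n∣m; m∣n*o⇒m/n∣o; m/n∣o⇒m∣o*n; ∣n⇒∣m*n)
open import Data.Nat.GCD using (gcd; gcd[m,n]∣m; gcd[m,n]∣n; gcd[m,n]≢0)
open import Data.Nat.Coprimality using (coprime-/gcd; coprime-divisor)
open import Data.Nat.Tactic.RingSolver using (solve-∀)
open import Data.Integer.Base using (+_; -_; _-_)
open import Data.Integer.DivMod using (_%ℕ_)
open import Data.Product.Base using (∃-syntax; _,_)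
open import Data.Sum.Base using (inj₁)
open import Function.Bundles using (_⇔_; mk⇔; Equivalence)
import Function.Properties.Equivalence as ⇔
open import Relation.Binary.PropositionalEquality
open import Relation.Nullary.Negation using (contradiction)

∑ : ℕ → (ℕ → ℕ) → ℕ
∑ zero    f = 0
∑ (suc n) f = ∑ n f + f n

∑-cong : ∀ n {f g : ℕ → ℕ} → (∀ {k} → k < n → f k ≡ g k) → ∑ n f ≡ ∑ n g
∑-cong zero    f≗g = refl
∑-cong (suc n) f≗g = cong₂ _+_ (∑-cong n (λ k<n → f≗g (m<n⇒m<1+n k<n))) (f≗g (n<1+n n))

∑-zero : ∀ n {f : ℕ → ℕ} → (∀ {k} → k < n → f k ≡ 0) → ∑ n f ≡ 0
∑-zero zero    f≗0 = refl
∑-zero (suc n) f≗0 = cong₂ _+_ (∑-zero n (λ k<n → f≗0 (m<n⇒m<1+n k<n))) (f≗0 (n<1+n n))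

∑-≤ : ∀ n {f : ℕ → ℕ} {c} → (∀ {k} → k < n → f k ≤ c) → ∑ n f ≤ n * c
∑-≤ zero    f≤c = z≤n
∑-≤ (suc n) {c = c} f≤c = begin
  ∑ n _ + _ ≤⟨ +-mono-≤ (∑-≤ n (λ k<n → f≤c (m<n⇒m<1+n k<n))) (f≤c (n<1+n n)) ⟩
  n * c + c ≡⟨ +-comm (n * c) c ⟩
  suc n * c ∎
  where open ≤-Reasoning

∑-head : ∀ n (f : ℕ → ℕ) → ∑ (suc n) f ≡ f 0 + ∑ n (λ k → f (suc k))
∑-head zero    f = sym (+-identityʳ (f 0))
∑-head (suc n) f = trans (cong (_+ f (suc n)) (∑-head n f)) (+-assoc (f 0) _ _)

∑-split : ∀ m n (f : ℕ → ℕ) → ∑ (m + n) f ≡ ∑ m f + ∑ n (λ j → f (m + j))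
∑-split m zero    f = trans (cong (λ l → ∑ l f) (+-identityʳ m)) (sym (+-identityʳ _))
∑-split m (suc n) f = begin
  ∑ (m + suc n) f                             ≡⟨ cong (λ l → ∑ l f) (+-suc m n) ⟩
  ∑ (m + n) f + f (m + n)                     ≡⟨ cong (_+ f (m + n)) (∑-split m n f) ⟩
  ∑ m f + ∑ n (λ j → f (m + j)) + f (m + n)   ≡⟨ +-assoc (∑ m f) _ _ ⟩
  ∑ m f + ∑ (suc n) (λ j → f (m + j))         ∎
  where open ≡-Reasoning

-- Congruences are carried in the subtraction-free form  f ≡ g + t * d.
∑-≡-mod : ∀ d n {f g : ℕ → ℕ} → (∀ k → ∃[ t ] f k ≡ g k + t * d) → ∃[ t ] ∑ n f ≡ ∑ n g + t * d
∑-≡-mod d zero    f≡g = 0 , refl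
∑-≡-mod d (suc n) {f} {g} f≡g with ∑-≡-mod d n f≡g | f≡g n
... | t , ∑f≡ | s , fₙ≡ = t + s , (begin
  ∑ n f + f n                     ≡⟨ cong₂ _+_ ∑f≡ fₙ≡ ⟩
  ∑ n g + t * d + (g n + s * d)   ≡⟨ regroup (∑ n g) (g n) t s d ⟩
  ∑ n g + g n + (t + s) * d       ∎)
  where
  open ≡-Reasoning
  regroup : ∀ A B t s d → A + t * d + (B + s * d) ≡ A + B + (t + s) * d
  regroup = solve-∀

geometric-sum : ∀ p n → ∑ n (suc p ^_) * p + 1 ≡ suc p ^ n
geometric-sum p zero    = refl
geometric-sum p (suc n) = begin
  (G + u) * p + 1       ≡⟨ regroup G u p ⟩
  (G * p + 1) + u * p   ≡⟨ cong (_+ u * p) (geometric-sum p n) ⟩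
  u + u * p             ≡⟨ cong (λ v → u + v) (*-comm u p) ⟩
  suc p * u             ∎
  where
  open ≡-Reasoning
  G = ∑ n (suc p ^_)
  u = suc p ^ n
  regroup : ∀ G u p → (G + u) * p + 1 ≡ (G * p + 1) + u * p
  regroup = solve-∀

^≡^%-mod : ∀ {x a p} .{{_ : NonZero a}} → x ^ a ≡ suc p → ∀ n → ∃[ t ] x ^ n ≡ x ^ (n % a) + t * p
^≡^%-mod {x} {a} {p} x^a≡1+p n = x ^ r * G , (begin
  x ^ n                 ≡⟨ cong (x ^_) (m≡m%n+[m/n]*n n a) ⟩
  x ^ (r + m * a)       ≡⟨ ^-distribˡ-+-* x r (m * a) ⟩
  x ^ r * x ^ (m * a)   ≡⟨ cong (λ e → x ^ r * x ^ e) (*-comm m a) ⟩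
  x ^ r * x ^ (a * m)   ≡⟨ cong (x ^ r *_) (sym (^-*-assoc x a m)) ⟩
  x ^ r * (x ^ a) ^ m   ≡⟨ cong (λ u → x ^ r * u ^ m) x^a≡1+p ⟩
  x ^ r * suc p ^ m     ≡⟨ cong (x ^ r *_) (sym (geometric-sum p m)) ⟩
  x ^ r * (G * p + 1)   ≡⟨ expand (x ^ r) G p ⟩
  x ^ r + x ^ r * G * p ∎)
  where
  open ≡-Reasoning
  expand : ∀ y G p → y * (G * p + 1) ≡ y + y * G * p
  expand = solve-∀
  r = n % a
  m = n / a
  G = ∑ m (suc p ^_)

δ₀ : ℕ → ℕ
δ₀ zero    = 1
δ₀ (suc _) = 0

δ₀-resp : ∀ {m n} → (m ≡ 0 ⇔ n ≡ 0) → δ₀ m ≡ δ₀ n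
δ₀-resp {zero}  {zero}  _   = refl
δ₀-resp {zero}  {suc _} m⇔n with () ← Equivalence.to m⇔n refl
δ₀-resp {suc _} {zero}  m⇔n with () ← Equivalence.from m⇔n refl
δ₀-resp {suc _} {suc _} _   = refl

^≡δ₀-mod : ∀ x e → ∃[ t ] x ^ e ≡ δ₀ e + t * x
^≡δ₀-mod x zero    = 0 , refl
^≡δ₀-mod x (suc e) = x ^ e , *-comm x (x ^ e)

∑δ₀[1+k%d]-period : ∀ d .{{_ : NonZero d}} → ∑ d (λ k → δ₀ (suc k % d)) ≡ 1
∑δ₀[1+k%d]-period (suc d) = cong₂ _+_
  (∑-zero d (λ k<d → cong δ₀ (m<n⇒m%n≡m (s≤s k<d))))
  (cong δ₀ (n%n≡0 (suc d)))

∑δ₀[1+k%d]≡m : ∀ d m .{{_ : NonZero d}} → ∑ (m * d) (λ k → δ₀ (suc k % d)) ≡ m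
∑δ₀[1+k%d]≡m d zero    = refl
∑δ₀[1+k%d]≡m d (suc m) = begin
  ∑ (d + m * d) f                          ≡⟨ ∑-split d (m * d) f ⟩
  ∑ d f + ∑ (m * d) (λ j → f (d + j))      ≡⟨ cong₂ _+_ (∑δ₀[1+k%d]-period d) (∑-cong (m * d) (λ _ → periodic _)) ⟩
  1 + ∑ (m * d) f                          ≡⟨ cong suc (∑δ₀[1+k%d]≡m d m) ⟩
  suc m                                    ∎
  where
  open ≡-Reasoning
  f : ℕ → ℕ
  f k = δ₀ (suc k % d)
  periodic : ∀ j → f (d + j) ≡ f j
  periodic j = cong δ₀ (trans (cong (_% d) (trans (sym (+-suc d j)) (+-comm d (suc j)))) ([m+n]%n≡m%n (suc j) d))

∑δ₀[k%d]≡1+m : ∀ d m .{{_ : NonZero d}} → ∑ (suc (m * d)) (λ k → δ₀ (k % d)) ≡ suc m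
∑δ₀[k%d]≡1+m d m = begin
  ∑ (suc (m * d)) (λ k → δ₀ (k % d))            ≡⟨ ∑-head (m * d) _ ⟩
  δ₀ (0 % d) + ∑ (m * d) (λ k → δ₀ (suc k % d)) ≡⟨ cong₂ _+_ (cong δ₀ (m<n⇒m%n≡m (ℕ.>-nonZero⁻¹ d))) (∑δ₀[1+k%d]≡m d m) ⟩
  suc m                                         ∎
  where open ≡-Reasoning

m∣n*o⇔m/gcd[m,n]∣o : ∀ m n o .{{_ : NonZero (gcd m n)}} → m ∣ n * o ⇔ m / gcd m n ∣ o
m∣n*o⇔m/gcd[m,n]∣o m n o = mk⇔
  (λ m∣no → coprime-divisor (coprime-/gcd m n) (m∣n*o⇒m/n∣o (gcd[m,n]∣m m n) (subst (m ∣_) (sym n*o≡) m∣no)))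
  (λ m′∣o → subst (m ∣_) n*o≡ (m/n∣o⇒m∣o*n (gcd[m,n]∣m m n) (∣n⇒∣m*n (n / gcd m n) m′∣o)))
  where
  open ≡-Reasoning
  g = gcd m n
  n*o≡ : n / g * o * g ≡ n * o
  n*o≡ = begin
    n / g * o * g   ≡⟨ swap (n / g) o g ⟩
    n / g * g * o   ≡⟨ cong (_* o) (m/n*n≡m (gcd[m,n]∣n m n)) ⟩
    n * o           ∎
    where
    swap : ∀ x y z → x * y * z ≡ x * z * y
    swap = solve-∀

∑δ₀[bk%a]≡1+gcd : ∀ a b .{{_ : NonZero a}} → ∑ (suc a) (λ k → δ₀ (b * k % a)) ≡ suc (gcd a b)
∑δ₀[bk%a]≡1+gcd a b = begin
  ∑ (suc a) (λ k → δ₀ (b * k % a))    ≡⟨ ∑-cong (suc a) (λ {k} _ → δ₀-resp (divisible⇔ k)) ⟩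
  ∑ (suc a) (λ k → δ₀ (k % a′))       ≡⟨ cong (λ l → ∑ (suc l) (λ k → δ₀ (k % a′))) (sym a≡g*a′) ⟩
  ∑ (suc (g * a′)) (λ k → δ₀ (k % a′)) ≡⟨ ∑δ₀[k%d]≡1+m a′ g ⟩
  suc g                               ∎
  where
  open ≡-Reasoning
  g = gcd a b
  instance
    g≢0 : NonZero g
    g≢0 = ≢-nonZero (gcd[m,n]≢0 a b (inj₁ (ℕ.≢-nonZero⁻¹ a)))
  a′ = a / g
  instance
    a′≢0 : NonZero a′
    a′≢0 = >-nonZero (m≥n⇒m/n>0 (∣⇒≤ (gcd[m,n]∣m a b)))
  a≡g*a′ : g * a′ ≡ a
  a≡g*a′ = m*[n/m]≡n (gcd[m,n]∣m a b)
  divisible⇔ : ∀ k → b * k % a ≡ 0 ⇔ k % a′ ≡ 0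
  divisible⇔ k = ⇔.trans (m%n≡0⇔n∣m (b * k) a) (⇔.trans (m∣n*o⇔m/gcd[m,n]∣o a b k) (⇔.sym (m%n≡0⇔n∣m k a′)))

powerResidueSum : (x a b : ℕ) .{{_ : NonZero a}} → ℕ
powerResidueSum x a b = ∑ (suc a) (λ k → x ^ (b * k % a))

∑[1+q]^k≡S-mod-p : ∀ {x a b p q} .{{_ : NonZero a}} → x ^ a ≡ suc p → x ^ b ≡ suc q →
  ∃[ t ] ∑ (suc a) (suc q ^_) ≡ powerResidueSum x a b + t * p
∑[1+q]^k≡S-mod-p {x} {a} {b} {p} {q} x^a≡1+p x^b≡1+q = ∑-≡-mod p (suc a) reduce
  where
  reduce : ∀ k → ∃[ t ] suc q ^ k ≡ x ^ (b * k % a) + t * p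
  reduce k with ^≡^%-mod {x} {a} {p} x^a≡1+p (b * k)
  ... | t , x^bk≡ = t , trans (trans (cong (_^ k) (sym x^b≡1+q)) (^-*-assoc x b k)) x^bk≡

x^[ab+a+b]≡x^a+qS-mod-pq : ∀ {x a b p q} .{{_ : NonZero a}} → x ^ a ≡ suc p → x ^ b ≡ suc q →
  ∃[ t ] x ^ (a * b + a + b) ≡ suc p + q * powerResidueSum x a b + t * (p * q)
x^[ab+a+b]≡x^a+qS-mod-pq {x} {a} {b} {p} {q} x^a≡1+p x^b≡1+q =
  let t , H≡S+tp = ∑[1+q]^k≡S-mod-p {x} {a} {b} x^a≡1+p x^b≡1+q in t + S + t * p , (begin
  x ^ (a * b + a + b)           ≡⟨ cong (x ^_) (exponent a b) ⟩
  x ^ (a + b * suc a)           ≡⟨ ^-distribˡ-+-* x a (b * suc a) ⟩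
  x ^ a * x ^ (b * suc a)       ≡⟨ cong (x ^ a *_) (sym (^-*-assoc x b (suc a))) ⟩
  x ^ a * (x ^ b) ^ suc a       ≡⟨ cong₂ (λ u v → u * v ^ suc a) x^a≡1+p x^b≡1+q ⟩
  suc p * suc q ^ suc a         ≡⟨ cong (suc p *_) (sym (geometric-sum q (suc a))) ⟩
  suc p * (H * q + 1)           ≡⟨ cong (λ h → suc p * (h * q + 1)) H≡S+tp ⟩
  suc p * ((S + t * p) * q + 1) ≡⟨ expand p q S t ⟩
  suc p + q * S + (t + S + t * p) * (p * q) ∎)
  where
  open ≡-Reasoning
  S = powerResidueSum x a b
  H = ∑ (suc a) (suc q ^_)
  exponent : ∀ a b → a * b + a + b ≡ a + b * suc a
  exponent = solve-∀
  expand : ∀ p q S t → suc p * ((S + t * p) * q + 1) ≡ suc p + q * S + (t + S + t * p) * (p * q)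
  expand = solve-∀

x^a+qS<pq : ∀ {x a p q S X} → suc p ≡ x * X → a + 4 ≤ x → x ≤ suc q → 0 < X → S ≤ suc a * X →
  suc p + q * S < p * q
x^a+qS<pq {x} {a} {p} {q} {S} {X} 1+p≡xX a+4≤x x≤1+q 0<X S≤[1+a]X = begin-strict
  suc p + q * S             ≡⟨ cong (_+ q * S) 1+p≡xX ⟩
  x * X + q * S             ≤⟨ +-monoˡ-≤ (q * S) (*-monoˡ-≤ X x≤1+q) ⟩
  X + q * X + q * S         <⟨ +-monoˡ-< (q * S) (+-monoˡ-< (q * X) X<qX) ⟩
  q * X + q * X + q * S     ≡⟨ collect q X S ⟩
  q * (S + 2 * X)           ≤⟨ *-monoʳ-≤ q S+2X≤p ⟩
  q * p                     ≡⟨ *-comm q p ⟩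
  p * q                     ∎
  where
  open ≤-Reasoning
  instance
    X≢0 : NonZero X
    X≢0 = >-nonZero 0<X
  1<q : 1 < q
  1<q = ≤-trans (n≤1+n 2) (s≤s⁻¹ (≤-trans (≤-trans (m≤n+m 4 a) a+4≤x) x≤1+q))
  X<qX : X < q * X
  X<qX = subst (X <_) (*-comm X q) (m<m*n X q 1<q)
  S+2X<1+p : S + 2 * X < suc p
  S+2X<1+p = begin-strict
    S + 2 * X               ≤⟨ +-monoˡ-≤ (2 * X) S≤[1+a]X ⟩
    suc a * X + 2 * X       ≡⟨ *-distribʳ-+ X (suc a) 2 ⟨
    (suc a + 2) * X         ≡⟨ cong (_* X) (+-suc a 2) ⟨
    (a + 3) * X             <⟨ *-monoˡ-< X (+-monoʳ-< a (n<1+n 3)) ⟩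
    (a + 4) * X             ≤⟨ *-monoˡ-≤ X a+4≤x ⟩
    x * X                   ≡⟨ 1+p≡xX ⟨
    suc p                   ∎
  S+2X≤p : S + 2 * X ≤ p
  S+2X≤p = s≤s⁻¹ S+2X<1+p
  collect : ∀ q X S → q * X + q * X + q * S ≡ q * (S + 2 * X)
  collect = solve-∀

-- Modulo x both suc p and suc q vanish, so p ≡ q ≡ −1 and r = pq − (1 + p) − qS ≡ 1 + S.
r+[1+p+qS]≡pq⇒r%x≡[1+S]%x : ∀ {r p q S x w z} .{{_ : NonZero x}} →
  r + (suc p + q * S) ≡ p * q → suc p ≡ x * w → suc q ≡ x * z → r % x ≡ suc S % x
r+[1+p+qS]≡pq⇒r%x≡[1+S]%x {r} {p} {q} {S} {x} {w} {z} r+[1+p+qS]≡pq 1+p≡wx 1+q≡zx = begin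
  r % x                                              ≡⟨ [m+kn]%n≡m%n r (2 * w + z * S + z) x ⟨
  (r + (2 * w + z * S + z) * x) % x                  ≡⟨ cong (_% x) (begin
    r + (2 * w + z * S + z) * x                      ≡⟨ spread r w z S x ⟩
    r + 2 * (x * w) + x * z * S + x * z              ≡⟨ cong₂ (λ u v → r + 2 * u + v * S + v) 1+p≡wx 1+q≡zx ⟨
    r + 2 * suc p + suc q * S + suc q                ≡⟨ regroup r p q S ⟩
    (r + (suc p + q * S)) + (suc p + S + suc q)      ≡⟨ cong (_+ (suc p + S + suc q)) r+[1+p+qS]≡pq ⟩
    p * q + (suc p + S + suc q)                      ≡⟨ factor p q S ⟩
    suc S + suc p * suc q                            ≡⟨ cong₂ (λ u v → suc S + u * v) 1+p≡wx 1+q≡zx ⟩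
    suc S + x * w * (x * z)                          ≡⟨ cong (λ n → suc S + n) (assoc w x z) ⟩
    suc S + w * x * z * x                            ∎) ⟩
  (suc S + w * x * z * x) % x                        ≡⟨ [m+kn]%n≡m%n (suc S) (w * x * z) x ⟩
  suc S % x                                          ∎
  where
  open ≡-Reasoning
  spread : ∀ r w z S x → r + (2 * w + z * S + z) * x ≡ r + 2 * (x * w) + x * z * S + x * z
  spread = solve-∀
  regroup : ∀ r p q S → r + 2 * suc p + suc q * S + suc q ≡ (r + (suc p + q * S)) + (suc p + S + suc q)
  regroup = solve-∀
  factor : ∀ p q S → p * q + (suc p + S + suc q) ≡ suc S + suc p * suc q
  factor = solve-∀
  assoc : ∀ w x z → x * w * (x * z) ≡ w * x * z * x
  assoc = solve-∀

-n%ℕd≡d∸n%d : ∀ n d .{{_ : NonZero d}} → n % d ≢ 0 → (- (+ n)) %ℕ d ≡ d ∸ n % d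
-n%ℕd≡d∸n%d zero    (suc d) 0%d≢0 = contradiction refl 0%d≢0
-n%ℕd≡d∸n%d (suc n) d       n%d≢0 with suc n % d
... | zero  = contradiction refl n%d≢0
... | suc _ = refl

[1+n]+4≤5^[1+n] : ∀ n → suc n + 4 ≤ 5 ^ suc n
[1+n]+4≤5^[1+n] zero    = ≤-refl
[1+n]+4≤5^[1+n] (suc n) = begin
  suc (suc n) + 4     ≤⟨ m≤m+n (suc (suc n) + 4) (4 * n + 19) ⟩
  (suc (suc n) + 4) + (4 * n + 19) ≡⟨ expand n ⟩
  5 * (suc n + 4)     ≤⟨ *-monoʳ-≤ 5 ([1+n]+4≤5^[1+n] n) ⟩
  5 * 5 ^ suc n       ∎
  where
  open ≤-Reasoning
  expand : ∀ n → (suc (suc n) + 4) + (4 * n + 19) ≡ 5 * (suc n + 4)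
  expand = solve-∀

[-x^[ab+a+b]%pq]%x≡2+gcd : ∀ {x a b p q} .{{_ : NonZero x}} .{{_ : NonZero (p * q)}} →
  a ≥ 1 → b ≥ 1 → a + 4 ≤ x → x ^ a ≡ suc p → x ^ b ≡ suc q →
  (- (+ (x ^ (a * b + a + b)))) %ℕ (p * q) % x ≡ suc (suc (gcd a b))
[-x^[ab+a+b]%pq]%x≡2+gcd {x} {a@(suc a₁)} {b@(suc b₁)} {p} {q} _ _ a+4≤x x^a≡1+p x^b≡1+q = begin
  (- (+ N)) %ℕ (p * q) % x      ≡⟨ cong (_% x) (-n%ℕd≡d∸n%d N (p * q) (subst (_≢ 0) (sym N%pq) λ ())) ⟩
  (p * q ∸ N % (p * q)) % x     ≡⟨ cong (λ n → (p * q ∸ n) % x) N%pq ⟩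
  (p * q ∸ (suc p + q * S)) % x ≡⟨ r+[1+p+qS]≡pq⇒r%x≡[1+S]%x (m∸n+n≡m (<⇒≤ bound)) (sym x^a≡1+p) (sym x^b≡1+q) ⟩
  suc S % x                     ≡⟨ 1+S%x≡1+c%x ⟩
  suc c % x                     ≡⟨ m<n⇒m%n≡m (subst (_< x) (cong suc (sym c≡1+g)) 2+g<x) ⟩
  suc c                         ≡⟨ cong suc c≡1+g ⟩
  suc (suc (gcd a b))           ∎
  where
  open ≡-Reasoning
  N = x ^ (a * b + a + b)
  S = powerResidueSum x a b
  bound : suc p + q * S < p * q
  bound = x^a+qS<pq (sym x^a≡1+p) a+4≤x x≤1+q (m^n>0 x a₁)
    (∑-≤ (suc a) (λ {k} _ → ^-monoʳ-≤ x (s≤s⁻¹ (m%n<n (b * k) a))))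
    where
    instance
      x^b₁≢0 : NonZero (x ^ b₁)
      x^b₁≢0 = m^n≢0 x b₁
    x≤1+q : x ≤ suc q
    x≤1+q = subst (x ≤_) x^b≡1+q (m≤m*n x (x ^ b₁))
  N%pq : N % (p * q) ≡ suc p + q * S
  N%pq = let t , N≡ = x^[ab+a+b]≡x^a+qS-mod-pq {x} {a} {b} x^a≡1+p x^b≡1+q in begin
    N % (p * q)                             ≡⟨ cong (_% (p * q)) N≡ ⟩
    (suc p + q * S + t * (p * q)) % (p * q) ≡⟨ [m+kn]%n≡m%n (suc p + q * S) t (p * q) ⟩
    (suc p + q * S) % (p * q)               ≡⟨ m<n⇒m%n≡m bound ⟩
    suc p + q * S                           ∎
  c = ∑ (suc a) (λ k → δ₀ (b * k % a))
  c≡1+g : c ≡ suc (gcd a b)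
  c≡1+g = ∑δ₀[bk%a]≡1+gcd a b
  1+S%x≡1+c%x : suc S % x ≡ suc c % x
  1+S%x≡1+c%x = let s , S≡c+sx = ∑-≡-mod x (suc a) (λ k → ^≡δ₀-mod x (b * k % a)) in
    trans (cong (λ n → suc n % x) S≡c+sx) ([m+kn]%n≡m%n (suc c) s x)
  2+g<x : suc (suc (gcd a b)) < x
  2+g<x = ≤-trans (+-monoʳ-≤ 3 (∣⇒≤ (gcd[m,n]∣m a b))) (≤-trans (n≤1+n (3 + a)) (subst (_≤ x) (+-comm a 4) a+4≤x))

corollary1 : (a b : ℕ) → a ≥ 1 → b ≥ 1 → .{{_ : NonZero (modulus a b)}} →
    + gcd a b ≡ + (_%_ ((- (+ (5 ℕ.^ (a ℕ.* b ℕ.* (a ℕ.* b ℕ.+ a ℕ.+ b))))) %ℕ modulus a b) (5 ℕ.^ (a ℕ.* b)) {{m^n≢0 5 (a ℕ.* b)}}) - + 2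
corollary1 a@(suc a₁) b@(suc _) a≥1 b≥1 = cong (λ n → + n - + 2) (sym (begin
  (- (+ (5 ^ (a * b * e)))) %ℕ modulus a b % x ≡⟨ cong (λ n → (- (+ n)) %ℕ modulus a b % x) (^-*-assoc 5 (a * b) e) ⟨
  (- (+ (x ^ e))) %ℕ modulus a b % x           ≡⟨ [-x^[ab+a+b]%pq]%x≡2+gcd a≥1 b≥1 a+4≤x x^a≡1+p x^b≡1+q ⟩
  suc (suc (gcd a b))                          ∎))
  where
  open ≡-Reasoning
  e = a * b + a + b
  x = 5 ^ (a * b)
  instance
    x≢0 : NonZero x
    x≢0 = m^n≢0 5 (a * b)
  a+4≤x : a + 4 ≤ x
  a+4≤x = ≤-trans ([1+n]+4≤5^[1+n] a₁) (^-monoʳ-≤ 5 (m≤m*n a b))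
  x^n≡1+[5^m∸1] : ∀ n m → a * b * n ≡ m → x ^ n ≡ suc (5 ^ m ∸ 1)
  x^n≡1+[5^m∸1] n m ab*n≡m = trans (trans (^-*-assoc 5 (a * b) n) (cong (5 ^_) ab*n≡m)) (sym (m+[n∸m]≡n (m^n>0 5 m)))
  x^a≡1+p : x ^ a ≡ suc (5 ^ (a * a * b) ∸ 1)
  x^a≡1+p = x^n≡1+[5^m∸1] a (a * a * b) (swap a b)
    where
    swap : ∀ a b → a * b * a ≡ a * a * b
    swap = solve-∀
  x^b≡1+q : x ^ b ≡ suc (5 ^ (a * b * b) ∸ 1)
  x^b≡1+q = x^n≡1+[5^m∸1] b (a * b * b) refl
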